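{- For an integer $k\ge 1$, let $T_k$ be the graph obtained by gluing $k$ copies of the triangle $K_3$ at a single common vertex, i.e., $V(T_k)=\{u,x_1,y_1,\dots,x_k,y_k\}$ and $E(T_k)=\{ux_i,uy_i,x_iy_i : 1\le i\le k\}$. Then $\Psi(L(T_k)) = 2k = |V(T_k)|-1$.
   Context: For a connected graph $H$ with distance $d_H$, a pair $\{x,y\}$ of vertices doubly resolves a pair $\{u,v\}$ if $d_H(u,x)-d_H(u,y)\neq d_H(v,x)-d_H(v,y)$; a set $S\subseteq V(H)$ is a doubly resolving set if every pair of distinct vertices of $H$ is doubly resolved by some pair of vertices of $S$, and $\Psi(H)$ is the minimum size of such a set. $L(G)$ denotes the line graph of $G$ (vertices are the edges of $G$, adjacent iff they share an end vertex). -}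

module Defs where

open import Data.Nat using (ℕ; zero; suc; _+_; _*_; _≤_; _<_)
open import Data.Bool using (Bool; true; false; _∧_; _∨_; not)
open import Data.Fin using (Fin; zero; suc; toℕ; combine; remQuot; _≟_)
open import Data.Fin.Subset using (Subset; _∈_; ∣_∣)
open import Data.Product using (_×_; _,_; proj₁; proj₂; ∃-syntax)
open import Data.Vec.Functional using (Vector)
open import Data.Integer using (ℤ; _-_; +_)
open import Relation.Binary.PropositionalEquality using (_≡_)
open import Relation.Nullary using (¬_; does)

-- A finite simple graph on vertex set Fin n, given by a (symmetric,
-- irreflexive) Boolean adjacency relation.
record Graph : Set where
  field
    size : ℕ
    adj  : Fin size → Fin size → Bool
open Graph public

anyFin : ∀ {n} → (Fin n → Bool) → Bool
anyFin {zero}  p = false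
anyFin {suc n} p = p zero ∨ anyFin (λ i → p (suc i))

reach : (G : Graph) → ℕ → Fin (size G) → Fin (size G) → Bool
reach G zero    u v = does (u ≟ v)
reach G (suc k) u v = reach G k u v ∨ anyFin (λ w → reach G k u w ∧ adj G w v)

-- least k ≤ bound with reach G k u v (or bound if none)
searchDist : (G : Graph) → Fin (size G) → Fin (size G) → ℕ → ℕ → ℕ
searchDist G u v k zero = k
searchDist G u v k (suc fuel) with reach G k u v
... | true  = k
... | false = searchDist G u v (suc k) fuel

-- graph distance d_G(u,v): the least length of a u–v walk.  In a connected
-- graph on n vertices this is < n, so searching k = 0 .. n suffices.
dist : (G : Graph) → Fin (size G) → Fin (size G) → ℕ
dist G u v = searchDist G u v 0 (size G)

DoublyResolves : (G : Graph) → (x y u v : Fin (size G)) → Set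
DoublyResolves G x y u v =
  ¬ ((+ dist G u x) - (+ dist G u y) ≡ (+ dist G v x) - (+ dist G v y))

IsDoublyResolving : (G : Graph) → Subset (size G) → Set
IsDoublyResolving G S =
  ∀ (u v : Fin (size G)) → ¬ (u ≡ v) →
    ∃[ x ] ∃[ y ] (x ∈ S × y ∈ S × DoublyResolves G x y u v)

PsiIs : (G : Graph) → ℕ → Set
PsiIs G p =
  (∃[ S ] (IsDoublyResolving G S × ∣ S ∣ ≡ p)) ×
  (∀ S → IsDoublyResolving G S → p ≤ ∣ S ∣)

-- A simple graph given by its vertex count and a list of its m edges
-- (each edge listed exactly once, by its two distinct end vertices).
record EdgeListGraph : Set where
  field
    nV   : ℕ
    nE   : ℕ
    ends : Fin nE → Fin nV × Fin nV
open EdgeListGraph public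

sameFin : ∀ {n} → Fin n → Fin n → Bool
sameFin a b = does (a ≟ b)

lineGraph : EdgeListGraph → Graph
lineGraph G = record
  { size = nE G
  ; adj  = λ e f →
      not (sameFin e f) ∧
      ( sameFin (proj₁ (ends G e)) (proj₁ (ends G f))
      ∨ sameFin (proj₁ (ends G e)) (proj₂ (ends G f))
      ∨ sameFin (proj₂ (ends G e)) (proj₁ (ends G f))
      ∨ sameFin (proj₂ (ends G e)) (proj₂ (ends G f)) ) }

-- Vertices: Fin (1 + k * 2);  u = zero,  x_i = suc (combine i 0),
-- y_i = suc (combine i 1)  for i : Fin k.
-- Edges: Fin (k * 3); edge (combine i j) is  u x_i (j=0), u y_i (j=1),
-- x_i y_i (j=2).
Tk-x Tk-y : (k : ℕ) → Fin k → Fin (suc (k * 2))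
Tk-x k i = suc (combine i zero)
Tk-y k i = suc (combine i (suc zero))

Tk-edge : (k : ℕ) → Fin k → Fin 3 → Fin (suc (k * 2)) × Fin (suc (k * 2))
Tk-edge k i zero             = zero , Tk-x k i
Tk-edge k i (suc zero)       = zero , Tk-y k i
Tk-edge k i (suc (suc zero)) = Tk-x k i , Tk-y k i

T : ℕ → EdgeListGraph
T k = record
  { nV   = suc (k * 2)
  ; nE   = k * 3
  ; ends = λ e → let (i , j) = remQuot {k} 3 e in Tk-edge k i j }

module Submission where

-- In L(T k) the three edges ux, uy, xy of a triangle are pairwise adjacent and the spokes ux, uy of
-- all triangles meet at the hub u, so edge j of one triangle is at distance 1 + rim j + rim j′ from
-- edge j′ of another, where rim xy = 1 and rim is 0 on spokes.  Such distances are certified by a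
-- labelling that is 0 at the source, grows by at most 1 along edges, and drops by 1 along some edge
-- into every other vertex.
--
-- The 2k spokes doubly resolve L(T k): ux and uy separate the edges of their own triangle, and two
-- edges of different triangles are separated by the spoke nearest to the first one and a spoke of
-- the second triangle.  Conversely a doubly resolving set S contains two edges of every triangle:
-- otherwise S meets some triangle inside {c}, and d(u, ·) - d(v, ·) is constant on S for u, v = ux, uy
-- if c = xy, and for u, v = xy, c if c is a spoke.

open import Defs
open import Data.Bool.Base as Bool using (Bool; true; false; _∨_; not; if_then_else_)
open import Data.Bool.Properties using (T-∧; T-∨)
open import Data.Fin.Base using (Fin; zero; suc; combine; remQuot)
open import Data.Fin.Properties
  using (_≟_; suc-injective; combine-injectiveˡ; combine-injectiveʳ; combine-surjective;
         remQuot-combine; nonZeroIndex)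
open import Data.Fin.Subset using (Subset; _∈_; _⊆_; ⁅_⁆; ∣_∣; inside; outside)
open import Data.Fin.Subset.Properties using (x∈p⇒∣p-x∣<∣p∣; x∈⁅y⁆⇒x≡y)
open import Data.Integer.Base as ℤ using (ℤ; +_; _⊖_)
open import Data.Integer.Properties using ([+m]-[+n]≡m⊖n; +-cancelˡ-⊖; pos-+; +-injective)
open import Data.Integer.Tactic.RingSolver using (solve-∀)
open import Data.Nat.Base using (ℕ; zero; suc; _+_; _*_; _∸_; _≤_; _<_; z≤n; s≤s)
open import Data.Nat.Properties
  using (≤-refl; ≤-reflexive; ≤-trans; ≤-antisym; ≤-pred; m≤n⇒m≤1+n; m≤m+n; m≤n*m; +-identityʳ;
         +-suc; ≤∧≢⇒<; <⇒≢; ≰⇒>; +-mono-<-≤; +-mono-≤; +-monoʳ-≤; *-comm; _≤?_; module ≤-Reasoning)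
open import Data.Product.Base using (_×_; _,_; proj₂; ∃-syntax; uncurry)
open import Data.Sum.Base using (_⊎_; inj₁; inj₂)
open import Data.Unit.Base using (tt)
open import Data.Vec.Base using ([]; _∷_; _++_; lookup; tabulate; splitAt; here; there)
open import Data.Vec.Properties
  using (lookup-++ˡ; lookup-++ʳ; tabulate-cong; tabulate∘lookup; lookup∘tabulate; []=⇒lookup;
         lookup⇒[]=)
open import Function.Base using (_∘_)
open import Function.Bundles using (_⇔_; mk⇔; module Equivalence)
open import Relation.Nullary.Decidable using (yes; no; dec-true; dec-false)
open import Relation.Nullary.Negation using (¬_; contradiction)
open import Relation.Binary.PropositionalEquality

open Equivalence using (to; from)

T-sameFin : ∀ {n} {a b : Fin n} → Bool.T (sameFin a b) ⇔ a ≡ b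
T-sameFin {a = a} {b} with a ≟ b
... | yes a≡b = mk⇔ (λ _ → a≡b) (λ _ → tt)
... | no  a≢b = mk⇔ (λ ()) a≢b

T-not-sameFin : ∀ {n} {a b : Fin n} → Bool.T (not (sameFin a b)) ⇔ a ≢ b
T-not-sameFin {a = a} {b} with a ≟ b
... | yes a≡b = mk⇔ (λ ()) (λ a≢b → a≢b a≡b)
... | no  a≢b = mk⇔ (λ _ → a≢b) (λ _ → tt)

sameFin-refl : ∀ {n} (a : Fin n) → sameFin a a ≡ true
sameFin-refl a = dec-true (a ≟ a) refl

sameFin-≢ : ∀ {n} {a b : Fin n} → a ≢ b → sameFin a b ≡ false
sameFin-≢ {a = a} {b} = dec-false (a ≟ b)

anyFin-sound : ∀ {n} (p : Fin n → Bool) → Bool.T (anyFin p) → ∃[ w ] Bool.T (p w)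
anyFin-sound {suc n} p h with to T-∨ h
... | inj₁ p0 = zero , p0
... | inj₂ ps = let w , pw = anyFin-sound (λ i → p (suc i)) ps in suc w , pw

anyFin-complete : ∀ {n} (p : Fin n → Bool) w → Bool.T (p w) → Bool.T (anyFin p)
anyFin-complete p zero    pw = from T-∨ (inj₁ pw)
anyFin-complete p (suc w) pw = from T-∨ (inj₂ (anyFin-complete (λ i → p (suc i)) w pw))

-- Distances certified by a labelling

Adjacent : (G : Graph) → Fin (size G) → Fin (size G) → Set
Adjacent G u v = Bool.T (adj G u v)

searchDist-least : ∀ {G u v d} → (∀ m → Bool.T (reach G m u v) ⇔ d ≤ m) →
  ∀ k fuel → k ≤ d → d ≤ k + fuel → searchDist G u v k fuel ≡ d
searchDist-least {d = d} reach⇔ k zero k≤d d≤k+0 =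
  ≤-antisym k≤d (subst (d ≤_) (+-identityʳ k) d≤k+0)
searchDist-least {G} {u} {v} {d} reach⇔ k (suc fuel) k≤d d≤k+1+fuel with reach G k u v in eq
... | true  = ≤-antisym k≤d (to (reach⇔ k) (subst Bool.T (sym eq) tt))
... | false =
  searchDist-least reach⇔ (suc k) fuel (≤∧≢⇒< k≤d k≢d) (subst (d ≤_) (+-suc k fuel) d≤k+1+fuel)
  where
  k≢d : k ≢ d
  k≢d refl = subst Bool.T eq (from (reach⇔ k) ≤-refl)

record DistanceLabelling (G : Graph) (s : Fin (size G)) : Set where
  field
    label     : Fin (size G) → ℕ
    source    : label s ≡ 0
    lipschitz : ∀ {w v} → Adjacent G w v → label v ≤ suc (label w)
    parent    : ∀ v → v ≢ s → ∃[ w ] Adjacent G w v × suc (label w) ≡ label v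
    bounded   : ∀ v → label v ≤ size G

module _ {G : Graph} {s : Fin (size G)} (ℓ : DistanceLabelling G s) where
  open DistanceLabelling ℓ

  reach⇒label≤ : ∀ m v → Bool.T (reach G m s v) → label v ≤ m
  reach⇒label≤ zero    v r with refl ← to (T-sameFin {a = s} {v}) r = ≤-reflexive source
  reach⇒label≤ (suc m) v r with to T-∨ r
  ... | inj₁ r′ = m≤n⇒m≤1+n (reach⇒label≤ m v r′)
  ... | inj₂ r′ with w , rw∧w~v ← anyFin-sound _ r′ with rw , w~v ← to T-∧ rw∧w~v =
    ≤-trans (lipschitz w~v) (s≤s (reach⇒label≤ m w rw))

  reach-source : ∀ m → Bool.T (reach G m s s)
  reach-source zero    = from (T-sameFin {a = s}) refl
  reach-source (suc m) = from T-∨ (inj₁ (reach-source m))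

  label≤⇒reach : ∀ m v → label v ≤ m → Bool.T (reach G m s v)
  label≤⇒reach m v ℓv≤m with v ≟ s
  ... | yes refl = reach-source m
  ... | no v≢s with w , w~v , ℓw<ℓv ← parent v v≢s =
    reach-via (subst (_≤ m) (sym ℓw<ℓv) ℓv≤m) w~v
    where
    reach-via : ∀ {m w v} → label w < m → Adjacent G w v → Bool.T (reach G m s v)
    reach-via {suc m} {w} (s≤s ℓw≤m) w~v =
      from T-∨ (inj₂ (anyFin-complete _ w (from T-∧ (label≤⇒reach m w ℓw≤m , w~v))))

  dist≡label : ∀ v → dist G s v ≡ label v
  dist≡label v =
    searchDist-least (λ m → mk⇔ (reach⇒label≤ m v) (label≤⇒reach m v)) 0 (size G) z≤n (bounded v)

-- Doubly resolving sets

[+m]-[+n]≡[+o]-[+p]⇒m+p≡n+o : ∀ m n o p → + m ℤ.- + n ≡ + o ℤ.- + p → m + p ≡ n + o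
[+m]-[+n]≡[+o]-[+p]⇒m+p≡n+o m n o p eq = +-injective (begin
  + (m + p)                       ≡⟨ pos-+ m p ⟩
  + m ℤ.+ + p                     ≡⟨ regroup (+ m) (+ n) (+ p) ⟩
  (+ m ℤ.- + n) ℤ.+ (+ n ℤ.+ + p) ≡⟨ cong (ℤ._+ (+ n ℤ.+ + p)) eq ⟩
  (+ o ℤ.- + p) ℤ.+ (+ n ℤ.+ + p) ≡⟨ cancel (+ o) (+ p) (+ n) ⟩
  + n ℤ.+ + o                     ≡⟨ pos-+ n o ⟨
  + (n + o)                       ∎)
  where
  open ≡-Reasoning
  regroup : ∀ a b c → a ℤ.+ c ≡ (a ℤ.- b) ℤ.+ (b ℤ.+ c)
  regroup = solve-∀
  cancel : ∀ a b c → (a ℤ.- b) ℤ.+ (c ℤ.+ b) ≡ c ℤ.+ a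
  cancel = solve-∀

[+m+n]-[+m+o]≡[+n]-[+o] : ∀ m n o → + (m + n) ℤ.- + (m + o) ≡ + n ℤ.- + o
[+m+n]-[+m+o]≡[+n]-[+o] m n o = begin
  + (m + n) ℤ.- + (m + o) ≡⟨ [+m]-[+n]≡m⊖n (m + n) (m + o) ⟩
  (m + n) ⊖ (m + o)       ≡⟨ +-cancelˡ-⊖ m n o ⟩
  n ⊖ o                   ≡⟨ [+m]-[+n]≡m⊖n n o ⟨
  + n ℤ.- + o             ∎
  where open ≡-Reasoning

module _ {G : Graph} where

  resolves-by-order : ∀ {x y u v} → dist G u x < dist G u y → dist G v y ≤ dist G v x →
    DoublyResolves G x y u v
  resolves-by-order {x} {y} {u} {v} ux<uy vy≤vx eq = <⇒≢ (+-mono-<-≤ ux<uy vy≤vx)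
    ([+m]-[+n]≡[+o]-[+p]⇒m+p≡n+o (dist G u x) (dist G u y) (dist G v x) (dist G v y) eq)

  shifted⇒¬DoublyResolves : ∀ {x y u v} c →
    dist G u x ≡ c + dist G v x → dist G u y ≡ c + dist G v y → ¬ DoublyResolves G x y u v
  shifted⇒¬DoublyResolves {x} {y} {u} {v} c ux≡c+vx uy≡c+vy dr = dr (begin
    + dist G u x ℤ.- + dist G u y             ≡⟨ cong₂ (λ a b → + a ℤ.- + b) ux≡c+vx uy≡c+vy ⟩
    + (c + dist G v x) ℤ.- + (c + dist G v y) ≡⟨ [+m+n]-[+m+o]≡[+n]-[+o] c _ _ ⟩
    + dist G v x ℤ.- + dist G v y             ∎)
    where open ≡-Reasoning

  shifted⇒¬IsDoublyResolving : ∀ {S u v} c → u ≢ v →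
    (∀ z → z ∈ S → dist G u z ≡ c + dist G v z) → ¬ IsDoublyResolving G S
  shifted⇒¬IsDoublyResolving c u≢v shift resolving
    with x , y , x∈S , y∈S , dr ← resolving _ _ u≢v =
    shifted⇒¬DoublyResolves c (shift x x∈S) (shift y y∈S) dr

-- Blocks of Fin (m * n)

data CombineView {m n} : Fin (m * n) → Set where
  combined : (i : Fin m) (j : Fin n) → CombineView (combine i j)

combineView : ∀ {m n} (e : Fin (m * n)) → CombineView {m} {n} e
combineView {m} {n} e with i , j , refl ← combine-surjective {m} {n} e = combined {m} {n} i j

combine-≢ˡ : ∀ {m n} {i i′ : Fin m} {j j′ : Fin n} → i ≢ i′ → combine i j ≢ combine i′ j′
combine-≢ˡ {i = i} {i′} {j} {j′} i≢i′ = i≢i′ ∘ combine-injectiveˡ i j i′ j′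

combine-≢ʳ : ∀ {m n} {i : Fin m} {j j′ : Fin n} → j ≢ j′ → combine i j ≢ combine i j′
combine-≢ʳ {i = i} {j} {j′} j≢j′ = j≢j′ ∘ combine-injectiveʳ i j i j′

block : ∀ {m n} → Subset (m * n) → Fin m → Subset n
block S i = tabulate (λ j → lookup S (combine i j))

combine∈⇒∈block : ∀ {m n} {S : Subset (m * n)} {i j} → combine i j ∈ S → j ∈ block S i
combine∈⇒∈block {m} {n} {S} {i} {j} ij∈S =
  lookup⇒[]= j (block {m} S i) (trans (lookup∘tabulate _ j) ([]=⇒lookup ij∈S))

∣p++q∣≡∣p∣+∣q∣ : ∀ {m n} (p : Subset m) (q : Subset n) → ∣ p ++ q ∣ ≡ ∣ p ∣ + ∣ q ∣
∣p++q∣≡∣p∣+∣q∣ []            q = refl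
∣p++q∣≡∣p∣+∣q∣ (outside ∷ p) q = ∣p++q∣≡∣p∣+∣q∣ p q
∣p++q∣≡∣p∣+∣q∣ (inside  ∷ p) q = cong suc (∣p++q∣≡∣p∣+∣q∣ p q)

≤∣block∣⇒*≤∣S∣ : ∀ m {n r} (S : Subset (m * n)) → (∀ i → r ≤ ∣ block S i ∣) → m * r ≤ ∣ S ∣
≤∣block∣⇒*≤∣S∣ zero    S _ = z≤n
≤∣block∣⇒*≤∣S∣ (suc m) {n} {r} S r≤ with p , q , refl ← splitAt n S = begin
  r + m * r     ≤⟨ +-mono-≤ (subst (λ b → r ≤ ∣ b ∣) first (r≤ zero))
                            (≤∣block∣⇒*≤∣S∣ m q (λ i → subst (λ b → r ≤ ∣ b ∣) (rest i) (r≤ (suc i)))) ⟩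
  ∣ p ∣ + ∣ q ∣ ≡⟨ ∣p++q∣≡∣p∣+∣q∣ p q ⟨
  ∣ p ++ q ∣    ∎
  where
  open ≤-Reasoning
  first : block {suc m} (p ++ q) zero ≡ p
  first = trans (tabulate-cong (lookup-++ˡ p q)) (tabulate∘lookup p)
  rest : ∀ i → block {suc m} (p ++ q) (suc i) ≡ block {m} q i
  rest i = tabulate-cong (λ j → lookup-++ʳ p q (combine i j))

∣p∣≤1⇒⊆⁅x⁆ : ∀ {n} (p : Subset (suc n)) → ∣ p ∣ ≤ 1 → ∃[ x ] p ⊆ ⁅ x ⁆
∣p∣≤1⇒⊆⁅x⁆ (inside ∷ p) (s≤s ∣p∣≤0) = zero , λ where
  here        → here
  (there y∈p) → contradiction (≤-trans (x∈p⇒∣p-x∣<∣p∣ y∈p) ∣p∣≤0) λ ()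
∣p∣≤1⇒⊆⁅x⁆ {zero}  (outside ∷ []) _    = zero , λ { (there ()) }
∣p∣≤1⇒⊆⁅x⁆ {suc n} (outside ∷ p) ∣p∣≤1 with x , p⊆⁅x⁆ ← ∣p∣≤1⇒⊆⁅x⁆ p ∣p∣≤1 =
  suc x , λ { (there y∈p) → there (p⊆⁅x⁆ y∈p) }

-- Line graphs

Incident : ∀ {n} → Fin n → Fin n × Fin n → Set
Incident v (a , b) = v ≡ a ⊎ v ≡ b

Meet : ∀ {n} → Fin n × Fin n → Fin n × Fin n → Set
Meet e f = ∃[ v ] Incident v e × Incident v f

Meet-sym : ∀ {n} {e f : Fin n × Fin n} → Meet e f → Meet f e
Meet-sym (v , v∈e , v∈f) = v , v∈f , v∈e

T-meet : ∀ {n} {a b a′ b′ : Fin n} →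
  Bool.T (sameFin a a′ ∨ sameFin a b′ ∨ sameFin b a′ ∨ sameFin b b′) ⇔ Meet (a , b) (a′ , b′)
T-meet {a = a} {b} {a′} {b′} with a ≟ a′ | a ≟ b′ | b ≟ a′ | b ≟ b′
... | yes refl | _        | _        | _        = mk⇔ (λ _ → a , inj₁ refl , inj₁ refl) _
... | no _     | yes refl | _        | _        = mk⇔ (λ _ → a , inj₁ refl , inj₂ refl) _
... | no _     | no _     | yes refl | _        = mk⇔ (λ _ → b , inj₂ refl , inj₁ refl) _
... | no _     | no _     | no _     | yes refl = mk⇔ (λ _ → b , inj₂ refl , inj₂ refl) _
... | no a≢a′  | no a≢b′  | no b≢a′  | no b≢b′  = mk⇔ (λ ()) λ where
  (_ , inj₁ refl , inj₁ refl) → a≢a′ refl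
  (_ , inj₁ refl , inj₂ refl) → a≢b′ refl
  (_ , inj₂ refl , inj₁ refl) → b≢a′ refl
  (_ , inj₂ refl , inj₂ refl) → b≢b′ refl

lineGraph-adj⇔ : ∀ G {e f} → Adjacent (lineGraph G) e f ⇔ (e ≢ f × Meet (ends G e) (ends G f))
lineGraph-adj⇔ G = mk⇔
  (λ t → let e≢f , meet = to T-∧ t in to T-not-sameFin e≢f , to T-meet meet)
  (λ (e≢f , meet) → from T-∧ (from T-not-sameFin e≢f , from T-meet meet))

-- The line graph of T k

L : ℕ → Graph
L k = lineGraph (T k)

pattern ux = zero
pattern uy = suc zero
pattern xy = suc (suc zero)

data IsSpoke : Fin 3 → Set where
  ux-spoke : IsSpoke ux
  uy-spoke : IsSpoke uy

spoke-or-rim : ∀ j → IsSpoke j ⊎ j ≡ xy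
spoke-or-rim ux = inj₁ ux-spoke
spoke-or-rim uy = inj₁ uy-spoke
spoke-or-rim xy = inj₂ refl

nearestSpoke : Fin 3 → Fin 3
nearestSpoke xy = ux
nearestSpoke j  = j

nearestSpoke-isSpoke : ∀ j → IsSpoke (nearestSpoke j)
nearestSpoke-isSpoke ux = ux-spoke
nearestSpoke-isSpoke uy = uy-spoke
nearestSpoke-isSpoke xy = ux-spoke

module _ {k : ℕ} where

  hub-incident : ∀ {i : Fin k} {j} → IsSpoke j → Incident zero (Tk-edge k i j)
  hub-incident ux-spoke = inj₁ refl
  hub-incident uy-spoke = inj₁ refl

  incident-rim : ∀ {i : Fin k} {v} → Incident v (Tk-edge k i xy) → ∃[ a ] v ≡ suc (combine i a)
  incident-rim (inj₁ refl) = zero , refl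
  incident-rim (inj₂ refl) = suc zero , refl

  incident-Tk-edge : ∀ {i : Fin k} {j v} → Incident v (Tk-edge k i j) →
    v ≡ zero ⊎ ∃[ a ] v ≡ suc (combine i a)
  incident-Tk-edge {j = ux} (inj₁ refl) = inj₁ refl
  incident-Tk-edge {j = ux} (inj₂ refl) = inj₂ (zero , refl)
  incident-Tk-edge {j = uy} (inj₁ refl) = inj₁ refl
  incident-Tk-edge {j = uy} (inj₂ refl) = inj₂ (suc zero , refl)
  incident-Tk-edge {j = xy} v∈e         = inj₂ (incident-rim v∈e)

  rim-meets-own-triangle : ∀ {i i′ : Fin k} {j′} → Meet (Tk-edge k i xy) (Tk-edge k i′ j′) → i ≡ i′
  rim-meets-own-triangle {i} {i′} {j′} (v , v∈e , v∈f)
    with incident-rim {i} v∈e | incident-Tk-edge {i′} {j′} v∈f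
  ... | a , refl | inj₁ ()
  ... | a , refl | inj₂ (b , eq) = combine-injectiveˡ i a i′ b (suc-injective eq)

  meet-across⇒spokes : ∀ {i i′ : Fin k} {j j′} → i ≢ i′ → Meet (Tk-edge k i j) (Tk-edge k i′ j′) →
    IsSpoke j × IsSpoke j′
  meet-across⇒spokes {i} {i′} {j} {j′} i≢i′ meet with spoke-or-rim j | spoke-or-rim j′
  ... | inj₂ refl | _         = contradiction (rim-meets-own-triangle {i} {i′} {j′} meet) i≢i′
  ... | inj₁ _    | inj₂ refl =
    contradiction (rim-meets-own-triangle {i′} {i} {j} (Meet-sym meet)) (i≢i′ ∘ sym)
  ... | inj₁ s    | inj₁ s′   = s , s′

  triangle-edges-meet : ∀ (i : Fin k) j j′ → Meet (Tk-edge k i j) (Tk-edge k i j′)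
  triangle-edges-meet i ux ux = _ , inj₁ refl , inj₁ refl
  triangle-edges-meet i ux uy = _ , inj₁ refl , inj₁ refl
  triangle-edges-meet i ux xy = _ , inj₂ refl , inj₁ refl
  triangle-edges-meet i uy ux = _ , inj₁ refl , inj₁ refl
  triangle-edges-meet i uy uy = _ , inj₁ refl , inj₁ refl
  triangle-edges-meet i uy xy = _ , inj₂ refl , inj₂ refl
  triangle-edges-meet i xy ux = _ , inj₁ refl , inj₂ refl
  triangle-edges-meet i xy uy = _ , inj₂ refl , inj₂ refl
  triangle-edges-meet i xy xy = _ , inj₁ refl , inj₁ refl

  ends-combine : ∀ (i : Fin k) j → ends (T k) (combine i j) ≡ Tk-edge k i j
  ends-combine i j = cong (uncurry (Tk-edge k)) (remQuot-combine i j)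

  L-adj⇔ : ∀ {i i′ : Fin k} {j j′} → Adjacent (L k) (combine i j) (combine i′ j′) ⇔
    (combine i j ≢ combine i′ j′ × Meet (Tk-edge k i j) (Tk-edge k i′ j′))
  L-adj⇔ {i} {i′} {j} {j′} =
    subst₂ (λ e f → Adjacent (L k) (combine i j) (combine i′ j′) ⇔
                     (combine i j ≢ combine i′ j′ × Meet e f))
      (ends-combine i j) (ends-combine i′ j′) (lineGraph-adj⇔ (T k))

  adj-within : ∀ {i : Fin k} {j j′} → j ≢ j′ → Adjacent (L k) (combine i j) (combine i j′)
  adj-within {i} {j} {j′} j≢j′ =
    from (L-adj⇔ {i} {i} {j} {j′}) (combine-≢ʳ {k} {3} {i} j≢j′ , triangle-edges-meet i j j′)

  adj-hub : ∀ {i i′ : Fin k} {j j′} → i ≢ i′ → IsSpoke j → IsSpoke j′ →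
    Adjacent (L k) (combine i j) (combine i′ j′)
  adj-hub {i} {i′} {j} {j′} i≢i′ s s′ = from (L-adj⇔ {i} {i′} {j} {j′})
    (combine-≢ˡ {k} {3} {i} {i′} {j} {j′} i≢i′ , zero , hub-incident s , hub-incident s′)

  adj-across⇒spokes : ∀ {i i′ : Fin k} {j j′} → i ≢ i′ → Adjacent (L k) (combine i j) (combine i′ j′) →
    IsSpoke j × IsSpoke j′
  adj-across⇒spokes {i} {i′} {j} {j′} i≢i′ =
    meet-across⇒spokes i≢i′ ∘ proj₂ ∘ to (L-adj⇔ {i} {i′} {j} {j′})

rim : Fin 3 → ℕ
rim xy = 1
rim _  = 0

sep : Fin 3 → Fin 3 → ℕ
sep j j′ = if sameFin j j′ then 0 else 1

rim≤1 : ∀ j → rim j ≤ 1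
rim≤1 ux = z≤n
rim≤1 uy = z≤n
rim≤1 xy = ≤-refl

rim-spoke : ∀ {j} → IsSpoke j → rim j ≡ 0
rim-spoke ux-spoke = refl
rim-spoke uy-spoke = refl

sep≤1 : ∀ j j′ → sep j j′ ≤ 1
sep≤1 j j′ with sameFin j j′
... | true  = z≤n
... | false = ≤-refl

sep-refl : ∀ j → sep j j ≡ 0
sep-refl j = cong (if_then 0 else 1) (sameFin-refl j)

sep-≢ : ∀ {j j′} → j ≢ j′ → sep j j′ ≡ 1
sep-≢ j≢j′ = cong (if_then 0 else 1) (sameFin-≢ j≢j′)

sep-nearestSpoke : ∀ j → sep j (nearestSpoke j) ≡ rim j
sep-nearestSpoke ux = refl
sep-nearestSpoke uy = refl
sep-nearestSpoke xy = refl

rim≤sep-spoke : ∀ {j′} → IsSpoke j′ → ∀ j → rim j ≤ sep j j′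
rim≤sep-spoke _        ux = z≤n
rim≤sep-spoke _        uy = z≤n
rim≤sep-spoke ux-spoke xy = ≤-refl
rim≤sep-spoke uy-spoke xy = ≤-refl

sep-xy-spoke : ∀ {c} → IsSpoke c → sep xy c ≡ suc (sep c c)
sep-xy-spoke ux-spoke = refl
sep-xy-spoke uy-spoke = refl

edgeDist : ∀ {k} → Fin k → Fin 3 → Fin k → Fin 3 → ℕ
edgeDist i j i′ j′ = if sameFin i i′ then sep j j′ else suc (rim j + rim j′)

module _ {k : ℕ} (i : Fin k) (j : Fin 3) where

  edgeDist-within : ∀ j′ → edgeDist i j i j′ ≡ sep j j′
  edgeDist-within j′ = cong (if_then sep j j′ else _) (sameFin-refl i)

  edgeDist-across : ∀ {i′ j′} → i ≢ i′ → edgeDist i j i′ j′ ≡ suc (rim j + rim j′)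
  edgeDist-across {j′ = j′} i≢i′ = cong (if_then sep j j′ else _) (sameFin-≢ i≢i′)

  edgeDist≤3 : ∀ i′ j′ → edgeDist i j i′ j′ ≤ 3
  edgeDist≤3 i′ j′ with sameFin i i′
  ... | true  = ≤-trans (sep≤1 j j′) (s≤s z≤n)
  ... | false = s≤s (+-mono-≤ (rim≤1 j) (rim≤1 j′))

  across-step : ∀ j₁ j₂ → suc (rim j + rim j₂) ≤ suc (suc (rim j + rim j₁))
  across-step j₁ j₂ = s≤s (begin
    rim j + rim j₂       ≤⟨ +-monoʳ-≤ (rim j) (≤-trans (rim≤1 j₂) (s≤s z≤n)) ⟩
    rim j + suc (rim j₁) ≡⟨ +-suc (rim j) (rim j₁) ⟩
    suc (rim j + rim j₁) ∎)
    where open ≤-Reasoning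

  edgeDist-step : ∀ i′ j₁ j₂ → edgeDist i j i′ j₂ ≤ suc (edgeDist i j i′ j₁)
  edgeDist-step i′ j₁ j₂ with i ≟ i′
  ... | yes refl = ≤-trans (sep≤1 j j₂) (s≤s z≤n)
  ... | no _     = across-step j₁ j₂

  edgeDist-hub-step : ∀ {i₁ i₂ j₁ j₂} → IsSpoke j₁ → IsSpoke j₂ →
    edgeDist i j i₂ j₂ ≤ suc (edgeDist i j i₁ j₁)
  edgeDist-hub-step {i₁} {i₂} {j₁} {j₂} s₁ s₂ with i ≟ i₂ | i ≟ i₁
  ... | yes refl | _        = ≤-trans (sep≤1 j j₂) (s≤s z≤n)
  ... | no _     | no _     = across-step j₁ j₂
  ... | no _     | yes refl = s≤s (begin
    rim j + rim j₂ ≡⟨ cong (λ r → rim j + r) (rim-spoke s₂) ⟩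
    rim j + 0      ≡⟨ +-identityʳ (rim j) ⟩
    rim j          ≤⟨ rim≤sep-spoke s₁ j ⟩
    sep j j₁       ∎)
    where open ≤-Reasoning

  edgeDist-lipschitz : ∀ {i₁ i₂ j₁ j₂} → Adjacent (L k) (combine i₁ j₁) (combine i₂ j₂) →
    edgeDist i j i₂ j₂ ≤ suc (edgeDist i j i₁ j₁)
  edgeDist-lipschitz {i₁} {i₂} {j₁} {j₂} w~v with i₁ ≟ i₂
  ... | yes refl = edgeDist-step i₁ j₁ j₂
  ... | no i₁≢i₂ = uncurry edgeDist-hub-step (adj-across⇒spokes i₁≢i₂ w~v)

  edgeDist-parent : ∀ i₂ j₂ → combine i₂ j₂ ≢ combine i j → ∃[ i₁ ] ∃[ j₁ ]
    Adjacent (L k) (combine i₁ j₁) (combine i₂ j₂) × suc (edgeDist i j i₁ j₁) ≡ edgeDist i j i₂ j₂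
  edgeDist-parent i₂ j₂ v≢s with i ≟ i₂
  ... | yes refl = i₂ , j , adj-within {i = i₂} j≢j₂ ,
    trans (cong suc (trans (edgeDist-within j) (sep-refl j))) (sym (sep-≢ j≢j₂))
    where
    j≢j₂ : j ≢ j₂
    j≢j₂ refl = v≢s refl
  ... | no i≢i₂ with spoke-or-rim j₂
  ...   | inj₂ refl = i₂ , ux , adj-within {i = i₂} (λ ()) ,
    cong suc (trans (edgeDist-across i≢i₂) (sym (+-suc (rim j) 0)))
  ...   | inj₁ s₂   = i , nearestSpoke j , adj-hub i≢i₂ (nearestSpoke-isSpoke j) s₂ , cong suc (begin
    edgeDist i j i (nearestSpoke j) ≡⟨ edgeDist-within (nearestSpoke j) ⟩
    sep j (nearestSpoke j)          ≡⟨ sep-nearestSpoke j ⟩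
    rim j                           ≡⟨ +-identityʳ (rim j) ⟨
    rim j + 0                       ≡⟨ cong (λ r → rim j + r) (rim-spoke s₂) ⟨
    rim j + rim j₂                  ∎)
    where open ≡-Reasoning

  edgeLabel : Fin (k * 3) → ℕ
  edgeLabel e = uncurry (edgeDist i j) (remQuot {k} 3 e)

  edgeLabel-combine : ∀ i′ j′ → edgeLabel (combine i′ j′) ≡ edgeDist i j i′ j′
  edgeLabel-combine i′ j′ = cong (uncurry (edgeDist i j)) (remQuot-combine i′ j′)

  edgeLabelling : DistanceLabelling (L k) (combine i j)
  edgeLabelling = record
    { label     = edgeLabel
    ; source    = trans (edgeLabel-combine i j) (trans (edgeDist-within j) (sep-refl j))
    ; lipschitz = lipschitz
    ; parent    = parent
    ; bounded   = bounded
    }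
    where
    lipschitz : ∀ {w v} → Adjacent (L k) w v → edgeLabel v ≤ suc (edgeLabel w)
    lipschitz {w} {v} w~v with combineView {k} {3} w | combineView {k} {3} v
    ... | combined i₁ j₁ | combined i₂ j₂ =
      subst₂ (λ a b → a ≤ suc b) (sym (edgeLabel-combine i₂ j₂)) (sym (edgeLabel-combine i₁ j₁))
        (edgeDist-lipschitz w~v)

    parent : ∀ v → v ≢ combine i j → ∃[ w ] Adjacent (L k) w v × suc (edgeLabel w) ≡ edgeLabel v
    parent v v≢s with combineView {k} {3} v
    ... | combined i₂ j₂ with i₁ , j₁ , w~v , eq ← edgeDist-parent i₂ j₂ v≢s =
      combine i₁ j₁ , w~v ,
      trans (cong suc (edgeLabel-combine i₁ j₁)) (trans eq (sym (edgeLabel-combine i₂ j₂)))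

    bounded : ∀ v → edgeLabel v ≤ k * 3
    bounded v with combineView {k} {3} v
    ... | combined i₂ j₂ = subst (_≤ k * 3) (sym (edgeLabel-combine i₂ j₂))
      (≤-trans (edgeDist≤3 i₂ j₂) (m≤n*m 3 k {{nonZeroIndex i}}))

  dist-edge : ∀ i′ j′ → dist (L k) (combine i j) (combine i′ j′) ≡ edgeDist i j i′ j′
  dist-edge i′ j′ = trans (dist≡label edgeLabelling (combine i′ j′)) (edgeLabel-combine i′ j′)

  dist-within : ∀ j′ → dist (L k) (combine i j) (combine i j′) ≡ sep j j′
  dist-within j′ = trans (dist-edge i j′) (edgeDist-within j′)

  dist-across : ∀ {i′} j′ → i ≢ i′ → dist (L k) (combine i j) (combine i′ j′) ≡ suc (rim j + rim j′)
  dist-across {i′} j′ i≢i′ = trans (dist-edge i′ j′) (edgeDist-across i≢i′)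

module _ {k : ℕ} (i : Fin k) where

  spokes-twins : ∀ i₂ j₂ → (i ≡ i₂ → j₂ ≡ xy) →
    dist (L k) (combine i ux) (combine i₂ j₂) ≡ 0 + dist (L k) (combine i uy) (combine i₂ j₂)
  spokes-twins i₂ j₂ only-xy with i ≟ i₂
  ... | yes refl with refl ← only-xy refl = trans (dist-within i ux xy) (sym (dist-within i uy xy))
  ... | no i≢i₂ = trans (dist-across i ux j₂ i≢i₂) (sym (dist-across i uy j₂ i≢i₂))

  rim-shifted : ∀ {c} → IsSpoke c → ∀ i₂ j₂ → (i ≡ i₂ → j₂ ≡ c) →
    dist (L k) (combine i xy) (combine i₂ j₂) ≡ 1 + dist (L k) (combine i c) (combine i₂ j₂)
  rim-shifted {c} s i₂ j₂ only-c with i ≟ i₂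
  ... | yes refl with refl ← only-c refl =
    trans (dist-within i xy c) (trans (sep-xy-spoke s) (cong suc (sym (dist-within i c c))))
  ... | no i≢i₂ = trans (dist-across i xy j₂ i≢i₂) (cong suc
    (trans (cong (λ r → suc (r + rim j₂)) (sym (rim-spoke s))) (sym (dist-across i c j₂ i≢i₂))))

  ∈S-elim : ∀ {S c} {P : Fin (k * 3) → Set} → block {k} S i ⊆ ⁅ c ⁆ →
    (∀ i₂ j₂ → (i ≡ i₂ → j₂ ≡ c) → P (combine i₂ j₂)) → ∀ z → z ∈ S → P z
  ∈S-elim {c = c} Sᵢ⊆⁅c⁆ h z z∈S with combineView {k} {3} z
  ... | combined i₂ j₂ = h i₂ j₂ (λ { refl → x∈⁅y⁆⇒x≡y c (Sᵢ⊆⁅c⁆ (combine∈⇒∈block {k} z∈S)) })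

  block⊆⁅_⁆⇒¬resolving : ∀ {S} c → block {k} S i ⊆ ⁅ c ⁆ → ¬ IsDoublyResolving (L k) S
  block⊆⁅ ux ⁆⇒¬resolving Sᵢ⊆⁅ux⁆ = shifted⇒¬IsDoublyResolving {L k} 1 (combine-≢ʳ {k} {3} {i} λ ())
    (∈S-elim Sᵢ⊆⁅ux⁆ (rim-shifted ux-spoke))
  block⊆⁅ uy ⁆⇒¬resolving Sᵢ⊆⁅uy⁆ = shifted⇒¬IsDoublyResolving {L k} 1 (combine-≢ʳ {k} {3} {i} λ ())
    (∈S-elim Sᵢ⊆⁅uy⁆ (rim-shifted uy-spoke))
  block⊆⁅ xy ⁆⇒¬resolving Sᵢ⊆⁅xy⁆ = shifted⇒¬IsDoublyResolving {L k} 0 (combine-≢ʳ {k} {3} {i} λ ())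
    (∈S-elim Sᵢ⊆⁅xy⁆ spokes-twins)

resolving⇒2≤∣block∣ : ∀ {k} {S : Subset (k * 3)} → IsDoublyResolving (L k) S →
  ∀ i → 2 ≤ ∣ block {k} S i ∣
resolving⇒2≤∣block∣ {k} {S} resolving i with 2 ≤? ∣ block {k} S i ∣
... | yes 2≤∣Sᵢ∣ = 2≤∣Sᵢ∣
... | no 2≰∣Sᵢ∣ with c , Sᵢ⊆⁅c⁆ ← ∣p∣≤1⇒⊆⁅x⁆ (block {k} S i) (≤-pred (≰⇒> 2≰∣Sᵢ∣)) =
  contradiction resolving (block⊆⁅ i ⁆⇒¬resolving c Sᵢ⊆⁅c⁆)

spokes : ∀ k → Subset (k * 3)
spokes zero    = []
spokes (suc k) = inside ∷ inside ∷ outside ∷ spokes k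

∣spokes∣ : ∀ k → ∣ spokes k ∣ ≡ k * 2
∣spokes∣ zero    = refl
∣spokes∣ (suc k) = cong (λ n → 2 + n) (∣spokes∣ k)

spoke∈spokes : ∀ {k} (i : Fin k) {j} → IsSpoke j → combine i j ∈ spokes k
spoke∈spokes zero    ux-spoke = here
spoke∈spokes zero    uy-spoke = there here
spoke∈spokes (suc i) s        = there (there (there (spoke∈spokes i s)))

spokeProfile : Fin 3 → ℤ
spokeProfile j = + sep j ux ℤ.- + sep j uy

spokeProfile-injective : ∀ {j j′} → spokeProfile j ≡ spokeProfile j′ → j ≡ j′
spokeProfile-injective {ux} {ux} _ = refl
spokeProfile-injective {uy} {uy} _ = refl
spokeProfile-injective {xy} {xy} _ = refl
spokeProfile-injective {ux} {uy} ()
spokeProfile-injective {ux} {xy} ()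
spokeProfile-injective {uy} {ux} ()
spokeProfile-injective {uy} {xy} ()
spokeProfile-injective {xy} {ux} ()
spokeProfile-injective {xy} {uy} ()

module _ {k : ℕ} where

  spokes-resolve-within : ∀ (i : Fin k) {j j′} → j ≢ j′ →
    DoublyResolves (L k) (combine i ux) (combine i uy) (combine i j) (combine i j′)
  spokes-resolve-within i {j} {j′} j≢j′ eq =
    j≢j′ (spokeProfile-injective (trans (sym (profile j)) (trans eq (profile j′))))
    where
    profile : ∀ j → + dist (L k) (combine i j) (combine i ux) ℤ.- + dist (L k) (combine i j) (combine i uy)
                    ≡ spokeProfile j
    profile j = cong₂ (λ a b → + a ℤ.- + b) (dist-within i j ux) (dist-within i j uy)

  spokes-resolve-across : ∀ {i i′ : Fin k} j j′ → i ≢ i′ →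
    DoublyResolves (L k) (combine i (nearestSpoke j)) (combine i′ ux) (combine i j) (combine i′ j′)
  spokes-resolve-across {i} {i′} j j′ i≢i′ = resolves-by-order {L k}
    (subst₂ _<_ (sym (trans (dist-within i j (nearestSpoke j)) (sep-nearestSpoke j)))
                (sym (dist-across i j ux i≢i′))
                (s≤s (m≤m+n (rim j) 0)))
    (subst₂ _≤_ (sym (dist-within i′ j′ ux))
                (sym (dist-across i′ j′ (nearestSpoke j) (i≢i′ ∘ sym)))
                (≤-trans (sep≤1 j′ ux) (s≤s z≤n)))

  spokes-resolving : IsDoublyResolving (L k) (spokes k)
  spokes-resolving u v u≢v with combineView {k} {3} u | combineView {k} {3} v
  ... | combined i j | combined i′ j′ with i ≟ i′
  ...   | yes refl = combine i ux , combine i uy , spoke∈spokes i ux-spoke , spoke∈spokes i uy-spoke ,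
    spokes-resolve-within i (u≢v ∘ cong (combine i))
  ...   | no i≢i′ = combine i (nearestSpoke j) , combine i′ ux ,
    spoke∈spokes i (nearestSpoke-isSpoke j) , spoke∈spokes i′ ux-spoke , spokes-resolve-across j j′ i≢i′

proposition2 : (k : ℕ) → 1 ≤ k →
    PsiIs (lineGraph (T k)) (2 * k) × (2 * k ≡ nV (T k) ∸ 1)
proposition2 k _ =
  ( (spokes k , spokes-resolving , trans (∣spokes∣ k) (*-comm k 2))
  , λ S resolving → subst (_≤ ∣ S ∣) (*-comm k 2) (≤∣block∣⇒*≤∣S∣ k S (resolving⇒2≤∣block∣ resolving)) )
  , *-comm 2 k
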